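{- Let $N$ be a $k$-XOR circulant network of size $n$ with automata set $V=\{0,\ldots,n-1\}$, global transition function $F$, and let $\widetilde{F}$ be the global transition function of its symmetric network. For any automaton $i\in V$ and any configuration $x\in\{0,1\}^n$, $\widetilde{F}(S_i(x))=S_i(F(x))$.
   Context: For integers $k\ge 2$ and $n\ge k$, a $k$-XOR circulant network of size $n$ has automata $V=\{0,\ldots,n-1\}$, configurations $x\in\{0,1\}^n$, and an interaction matrix $\mathcal{C}$ ($n\times n$, $0/1$, $\mathcal{C}_{i,j}=1$ iff automaton $j$ influences automaton $i$) which is circulant, $\mathcal{C}_{i,j}=c_{(j-i)\bmod n}$ for some $(c_0,\ldots,c_{n-1})$, has exactly $k$ ones in each row, and satisfies $c_{n-1}=1$; the local functions are $f_i(x)=\sum_j\mathcal{C}_{i,j}x_j\bmod 2$ and under parallel updating the global transition function is $F(x)=\mathcal{C}x\bmod 2$. The symmetric network is the $k$-XOR circulant network with interaction matrix $\mathcal{C}^T$; its global transition function is $\widetilde{F}(x)=\mathcal{C}^Tx\bmod 2$. For $i\in V$ and $x\in\{0,1\}^n$, $S_i(x)$ is the configuration with $S_i(x)_j=x_{(2i-j)\bmod n}$ for all $j\in V$ (the symmetric of $x$ with respect to $i$). -}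

module Defs where

open import Data.Nat using (ℕ; zero; suc; _+_; _*_; _∸_; _≤_; NonZero)
open import Data.Nat.DivMod using (_%_; m%n<n)
open import Data.Fin using (Fin; toℕ; fromℕ<; fromℕ)
open import Data.Bool using (Bool; true; false; _xor_; _∧_)
open import Relation.Binary.PropositionalEquality using (_≡_)

Config : ℕ → Set
Config n = Fin n → Bool

⊕ : ∀ {n} → (Fin n → Bool) → Bool
⊕ {zero}  f = false
⊕ {suc n} f = f Data.Fin.zero xor ⊕ (λ j → f (Data.Fin.suc j))

count : ∀ {n} → (Fin n → Bool) → ℕ
count {zero}  f = 0
count {suc n} f = if′ (f Data.Fin.zero) + count (λ j → f (Data.Fin.suc j))
  where
  if′ : Bool → ℕ
  if′ true  = 1
  if′ false = 0

mod : (n : ℕ) → .{{NonZero n}} → ℕ → Fin n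
mod n a = fromℕ< (m%n<n a n)

diff : (n : ℕ) → .{{NonZero n}} → Fin n → Fin n → Fin n
diff n i j = mod n (toℕ j + (n ∸ toℕ i))

circ : (n : ℕ) → .{{NonZero n}} → (Fin n → Bool) → Fin n → Fin n → Bool
circ n c i j = c (diff n i j)

transpose : ∀ {n} → (Fin n → Fin n → Bool) → Fin n → Fin n → Bool
transpose C i j = C j i

-- Global transition function F(x) = C x mod 2 (parallel updating)
globalF : ∀ {n} → (Fin n → Fin n → Bool) → Config n → Config n
globalF C x i = ⊕ (λ j → C i j ∧ x j)

-- k-XOR circulant coefficient vector: exactly k ones in each row
-- (equivalently in c, as rows are rotations of c) and c_{n-1} = 1.
record IsKXorCirculant (k n : ℕ) .{{_ : NonZero n}} (c : Fin n → Bool) : Set where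
  field
    two≤k  : 2 ≤ k
    k≤n    : k ≤ n
    kOnes  : ∀ i → count (circ n c i) ≡ k
    last   : c (mod n (n ∸ 1)) ≡ true

sym : (n : ℕ) → .{{NonZero n}} → Fin n → Config n → Config n
sym n i x j = x (mod n (2 * toℕ i + (n ∸ toℕ j)))

-- Reflection about i, m ↦ 2i − m, is an involution of ℤ/n, and it turns the offset j − m
-- into m − (2i − j): (2i − m) and j have the same difference as m and (2i − j). Reindexing
-- the XOR-sum defining F̃(S_i x)_j by this reflection therefore yields the sum defining
-- F(x)_{2i−j} = S_i(F x)_j term by term.
module Submission where

open import Defs
open import Data.Nat using (ℕ; NonZero; _+_; _*_; _∸_; _%_; _<_; >-nonZero⁻¹)
open import Data.Nat.Properties using (+-assoc; +-comm; +-identityʳ; m+[n∸m]≡n; <⇒≤)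
open import Data.Nat.DivMod using (%-distribˡ-+; m%n%n≡m%n; n%n≡0; m<n⇒m%n≡m; m%n<n)
open import Data.Nat.Tactic.RingSolver using (solve-∀)
open import Data.Fin using (Fin; toℕ)
open import Data.Fin.Properties using (toℕ-fromℕ<; toℕ-injective; toℕ<n)
open import Data.Fin.Permutation using (permutation)
open import Data.Bool using (Bool; _xor_; _∧_)
open import Data.Bool.Properties using (xor-∧-commutativeRing)
open import Algebra.Bundles using (CommutativeRing)
open import Function using (_∘_)
open import Relation.Binary.PropositionalEquality
  using (_≡_; _≗_; refl; trans; cong; cong₂; module ≡-Reasoning)
  renaming (sym to ≡-sym)
import Algebra.Properties.CommutativeMonoid.Sum as CommutativeMonoidSum

open CommutativeMonoidSum (CommutativeRing.+-commutativeMonoid xor-∧-commutativeRing)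
  using (sum; sum-cong-≋; sum-permute)

⊕≡sum : ∀ {n} (f : Fin n → Bool) → ⊕ f ≡ sum f
⊕≡sum {ℕ.zero}  f = refl
⊕≡sum {ℕ.suc n} f = cong (f Fin.zero xor_) (⊕≡sum (f ∘ Fin.suc))

⊕-cong : ∀ {n} {f g : Fin n → Bool} → f ≗ g → ⊕ f ≡ ⊕ g
⊕-cong {f = f} {g} f≗g = trans (⊕≡sum f) (trans (sum-cong-≋ f≗g) (≡-sym (⊕≡sum g)))

⊕-reindex-involution : ∀ {n} (π : Fin n → Fin n) → (∀ m → π (π m) ≡ m) →
                       (f : Fin n → Bool) → ⊕ f ≡ ⊕ (f ∘ π)
⊕-reindex-involution π π∘π f = begin
  ⊕ f         ≡⟨ ⊕≡sum f ⟩
  sum f       ≡⟨ sum-permute f (permutation π π π∘π π∘π) ⟩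
  sum (f ∘ π) ≡⟨ ≡-sym (⊕≡sum (f ∘ π)) ⟩
  ⊕ (f ∘ π)   ∎
  where open ≡-Reasoning

module Modular (n : ℕ) .{{_ : NonZero n}} where

  infix 4 _≈_
  _≈_ : ℕ → ℕ → Set
  a ≈ b = a % n ≡ b % n

  ≈-trans : ∀ {a b c} → a ≈ b → b ≈ c → a ≈ c
  ≈-trans = trans

  ≈-sym : ∀ {a b} → a ≈ b → b ≈ a
  ≈-sym = ≡-sym

  ≡⇒≈ : ∀ {a b} → a ≡ b → a ≈ b
  ≡⇒≈ = cong (_% n)

  %-≈ : ∀ a → a % n ≈ a
  %-≈ a = m%n%n≡m%n a n

  +-congʳ : ∀ {a a′} b → a ≈ a′ → a + b ≈ a′ + b
  +-congʳ {a} {a′} b a≈a′ = begin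
    (a + b) % n              ≡⟨ %-distribˡ-+ a b n ⟩
    (a % n + b % n) % n      ≡⟨ cong (λ t → (t + b % n) % n) a≈a′ ⟩
    (a′ % n + b % n) % n     ≡⟨ ≡-sym (%-distribˡ-+ a′ b n) ⟩
    (a′ + b) % n             ∎
    where open ≡-Reasoning

  +-congˡ : ∀ a {b b′} → b ≈ b′ → a + b ≈ a + b′
  +-congˡ a {b} {b′} b≈b′ =
    ≈-trans (≡⇒≈ (+-comm a b)) (≈-trans (+-congʳ a b≈b′) (≡⇒≈ (+-comm b′ a)))

  neg : ℕ → ℕ
  neg a = n ∸ a % n

  neg-cong : ∀ {a b} → a ≈ b → neg a ≡ neg b
  neg-cong = cong (n ∸_)

  <⇒∸≡neg : ∀ {a} → a < n → n ∸ a ≡ neg a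
  <⇒∸≡neg a<n = cong (n ∸_) (≡-sym (m<n⇒m%n≡m a<n))

  +-inverseʳ : ∀ a → a + neg a ≈ 0
  +-inverseʳ a = begin
    (a + neg a) % n       ≡⟨ +-congʳ (neg a) (≡-sym (%-≈ a)) ⟩
    (a % n + neg a) % n   ≡⟨ cong (_% n) (m+[n∸m]≡n (<⇒≤ (m%n<n a n))) ⟩
    n % n                 ≡⟨ n%n≡0 n ⟩
    0                     ≡⟨ ≡-sym (m<n⇒m%n≡m (>-nonZero⁻¹ n)) ⟩
    0 % n                 ∎
    where open ≡-Reasoning

  +-absorbʳ : ∀ a {z} → z ≈ 0 → a + z ≈ a
  +-absorbʳ a z≈0 = ≈-trans (+-congˡ a z≈0) (≡⇒≈ (+-identityʳ a))

  sub-intro : ∀ {a b c} → a + b ≈ c → a ≈ c + neg b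
  sub-intro {a} {b} {c} a+b≈c =
    ≈-trans (≈-sym (+-absorbʳ a (+-inverseʳ b)))
    (≈-trans (≡⇒≈ (≡-sym (+-assoc a b (neg b)))) (+-congʳ (neg b) a+b≈c))

  reflection-involutive : ∀ a m → a + neg (a + neg m) ≈ m
  reflection-involutive a m = ≈-sym (sub-intro m+[a-m]≈a)
    where
    m+[a-m]≈a : m + (a + neg m) ≈ a
    m+[a-m]≈a = ≈-trans (≡⇒≈ (reorder m a (neg m))) (+-absorbʳ a (+-inverseʳ m))
      where
      reorder : ∀ x y z → x + (y + z) ≡ y + (x + z)
      reorder = solve-∀

  reflection-difference : ∀ a j m → j + neg (a + neg m) ≈ m + neg (a + neg j)
  reflection-difference a j m = sub-intro (≈-trans (≡⇒≈ (reorder j (neg (a + neg m)) a (neg j)))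
    (≈-trans (+-congʳ (neg (a + neg m)) (+-absorbʳ a (+-inverseʳ j)))
    (reflection-involutive a m)))
    where
    reorder : ∀ x y z w → x + y + (z + w) ≡ z + (x + w) + y
    reorder = solve-∀

  toℕ-mod : ∀ a → toℕ (mod n a) ≈ a
  toℕ-mod a = trans (cong (_% n) (toℕ-fromℕ< (m%n<n a n))) (%-≈ a)

  mod-cong : ∀ {a b} → a ≈ b → mod n a ≡ mod n b
  mod-cong {a} {b} a≈b = toℕ-injective (begin
    toℕ (mod n a)  ≡⟨ toℕ-fromℕ< (m%n<n a n) ⟩
    a % n          ≡⟨ a≈b ⟩
    b % n          ≡⟨ ≡-sym (toℕ-fromℕ< (m%n<n b n)) ⟩
    toℕ (mod n b)  ∎)
    where open ≡-Reasoning

  mod-toℕ : ∀ (m : Fin n) → mod n (toℕ m) ≡ m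
  mod-toℕ m = toℕ-injective (trans (toℕ-fromℕ< (m%n<n (toℕ m) n)) (m<n⇒m%n≡m (toℕ<n m)))

  ∸-toℕ-mod≡neg : ∀ a → n ∸ toℕ (mod n a) ≡ neg a
  ∸-toℕ-mod≡neg a = trans (<⇒∸≡neg (toℕ<n (mod n a))) (neg-cong (toℕ-mod a))

  reflect : Fin n → Fin n → Fin n
  reflect i m = mod n (2 * toℕ i + (n ∸ toℕ m))

  reflect-involutive : ∀ i m → reflect i (reflect i m) ≡ m
  reflect-involutive i m = begin
    mod n (I₂ + (n ∸ toℕ (reflect i m)))  ≡⟨ cong (λ t → mod n (I₂ + t)) (∸-toℕ-mod≡neg _) ⟩
    mod n (I₂ + neg (I₂ + (n ∸ M)))       ≡⟨ cong (λ t → mod n (I₂ + neg (I₂ + t))) (<⇒∸≡neg (toℕ<n m)) ⟩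
    mod n (I₂ + neg (I₂ + neg M))         ≡⟨ mod-cong (reflection-involutive I₂ M) ⟩
    mod n M                               ≡⟨ mod-toℕ m ⟩
    m                                     ∎
    where
    open ≡-Reasoning
    I₂ = 2 * toℕ i
    M = toℕ m

  diff-reflect : ∀ i j m → diff n (reflect i m) j ≡ diff n (reflect i j) m
  diff-reflect i j m = begin
    mod n (J + (n ∸ toℕ (reflect i m)))  ≡⟨ cong (λ t → mod n (J + t)) (∸-toℕ-mod≡neg _) ⟩
    mod n (J + neg (I₂ + (n ∸ M)))       ≡⟨ cong (λ t → mod n (J + neg (I₂ + t))) (<⇒∸≡neg (toℕ<n m)) ⟩
    mod n (J + neg (I₂ + neg M))         ≡⟨ mod-cong (reflection-difference I₂ J M) ⟩
    mod n (M + neg (I₂ + neg J))         ≡⟨ cong (λ t → mod n (M + neg (I₂ + t))) (≡-sym (<⇒∸≡neg (toℕ<n j))) ⟩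
    mod n (M + neg (I₂ + (n ∸ J)))       ≡⟨ cong (λ t → mod n (M + t)) (≡-sym (∸-toℕ-mod≡neg _)) ⟩
    mod n (M + (n ∸ toℕ (reflect i j)))  ∎
    where
    open ≡-Reasoning
    I₂ = 2 * toℕ i
    J = toℕ j
    M = toℕ m

lemma2 : (k n : ℕ) → .{{_ : NonZero n}} → (c : Fin n → Bool) →
         IsKXorCirculant k n c →
         (i : Fin n) → (x : Config n) → (j : Fin n) →
         globalF (transpose (circ n c)) (sym n i x) j ≡ sym n i (globalF (circ n c) x) j
lemma2 k n c _ i x j =
  trans (⊕-reindex-involution (reflect i) (reflect-involutive i) summand)
        (⊕-cong λ m → cong₂ (λ d y → c d ∧ x y) (diff-reflect i j m) (reflect-involutive i m))
  where
  open Modular n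
  summand : Fin n → Bool
  summand m = c (diff n m j) ∧ x (reflect i m)
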